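{- Let $T[1,n]=Z[1]Z[2]\cdots Z[n']$ be the LZ-End parsing of $T$. Then the height $H$ of this parsing satisfies $H\le \max_{1\le p\le n'}|Z[p]|$.
   Context: LZ-End parsing: built left to right; having processed $T[1,i-1]$ into $Z[1,p-1]$, find the longest prefix $T[i,i'-1]$ of $T[i,n]$ that is a suffix of $Z[1]\cdots Z[q]$ for some $q<p$ (this occurrence $T[c,d]$ ending at the end of phrase $Z[q]$ is the source of the phrase), set $Z[p]=T[i,i']$ and continue with $i=i'+1$. Height: for each phrase $Z[p]=T[a,b]$ with source $T[c,d]$ (so $d-c=b-a-1$ and $d<a$), define $C[b]=1$ and $C[k]=C[(k-a)+c]+1$ for $a\le k<b$ (this is well defined by induction on position). The height of the parsing is $H=\max_{1\le i\le n}C[i]$. -}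

module Defs where

open import Data.Nat using (ℕ; zero; suc; _+_; _∸_; _≤_; _<_; _⊔_)
open import Data.List using (List; []; _∷_; length; map; foldr)
open import Data.List.Membership.Propositional using (_∈_)
open import Data.List.Relation.Unary.All using (All)
open import Data.Maybe using (Maybe; just; nothing)
open import Data.Product using (Σ; ∃; _×_; _,_)
open import Data.Sum using (_⊎_)
open import Relation.Binary.PropositionalEquality using (_≡_)

-- Conventions: positions are 0-indexed (paper position j is our j-1).
-- A text is a list T over an arbitrary alphabet A, n = length T.

_at_ : {A : Set} → List A → ℕ → Maybe A
[]      at _     = nothing
(x ∷ _) at zero  = just x
(_ ∷ T) at suc i = T at i

-- A phrase is recorded as (a , ℓ , t):
--   the phrase is T[a, a+ℓ] (inclusive, length ℓ+1),
--   its copied part T[a, a+ℓ-1] has source T[t-ℓ, t-1],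
--   which ends exactly at the end of an earlier phrase (t = exclusive end).
Phrase : Set
Phrase = ℕ × ℕ × ℕ

phraseLength : Phrase → ℕ
phraseLength (a , ℓ , t) = suc ℓ

-- T[i, i+ℓ-1] is a suffix of Z[1]⋯Z[q], where t is the (exclusive) end of Z[q];
-- Es is the list of (exclusive) end positions of the previous phrases.
SourceAt : {A : Set} → List A → List ℕ → ℕ → ℕ → ℕ → Set
SourceAt T Es i ℓ t =
  t ∈ Es × ℓ ≤ t × (∀ k → k < ℓ → T at (t ∸ ℓ + k) ≡ T at (i + k))

Candidate : {A : Set} → List A → List ℕ → ℕ → ℕ → Set
Candidate T Es i ℓ = ℓ ≡ 0 ⊎ ∃ (λ t → SourceAt T Es i ℓ t)

-- LZEndFrom T Es i Z : Z is the LZ-End parsing of T[i, n-1], given that the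
-- phrases already built have (exclusive) ends Es.  At each step the longest
-- admissible prefix T[i, i+ℓ-1] (leaving room for the explicit final
-- character T[i+ℓ]) is taken, with a chosen source.
data LZEndFrom {A : Set} (T : List A) : List ℕ → ℕ → List Phrase → Set where
  done : ∀ Es → LZEndFrom T Es (length T) []
  step : ∀ Es i ℓ t Z →
         i + ℓ < length T →
         (ℓ ≡ 0 ⊎ SourceAt T Es i ℓ t) →
         (∀ ℓ′ → Candidate T Es i ℓ′ → i + ℓ′ < length T → ℓ′ ≤ ℓ) →
         LZEndFrom T (suc (i + ℓ) ∷ Es) (suc (i + ℓ)) Z →
         LZEndFrom T Es i ((i , ℓ , t) ∷ Z)

IsLZEnd : {A : Set} → List A → List Phrase → Set
IsLZEnd T Z = LZEndFrom T [] 0 Z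

IsHeightArray : List Phrase → (ℕ → ℕ) → Set
IsHeightArray Z C =
  All (λ { (a , ℓ , t) → C (a + ℓ) ≡ 1 × (∀ k → k < ℓ → C (a + k) ≡ suc (C (t ∸ ℓ + k))) }) Z

maxUpTo : (ℕ → ℕ) → ℕ → ℕ
maxUpTo C zero    = 0
maxUpTo C (suc n) = maxUpTo C n ⊔ C n

maxPhraseLength : List Phrase → ℕ
maxPhraseLength Z = foldr _⊔_ 0 (map phraseLength Z)

module Submission where

-- Call a position e "settled" when every x < e
-- satisfies C[x] + x ≤ e, i.e. C[x] is at most the distance from x to e.
-- We show, scanning the parsing left to right, that every phrase end is
-- settled.  For a phrase T[i, i+ℓ] with source ending at an earlier phrase
-- end t (settled by induction), the copied position i+k (k < ℓ) has
-- C[i+k] = C[t-ℓ+k] + 1 ≤ (ℓ - k) + 1, and the explicit last character has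
-- height 1; so C[i+k] + k ≤ ℓ + 1 for all k ≤ ℓ (lemma phrase-height).  This
-- both settles the new phrase end and bounds C inside the phrase by the
-- phrase length ℓ + 1.  An induction over the parsing (heights-bounded)
-- then bounds every C[x] by the maximal phrase length, and a final lemma
-- about maxUpTo turns the pointwise bound into the theorem.
-- Note that only the shape of the parsing is used, not the maximality of
-- the chosen phrases.

open import Defs
open import Data.Nat using (ℕ; zero; suc; _+_; _∸_; _≤_; _<_; _⊔_; z≤n; s≤s; _<?_)
open import Data.Nat.Properties
open import Algebra.Properties.CommutativeSemigroup +-commutativeSemigroup
  using (x∙yz≈y∙xz)
open import Data.List using (List; []; _∷_; length)
open import Data.List.Relation.Unary.All using (All; []; _∷_; lookup)
open import Data.Product using (Σ-syntax; _×_; _,_)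
open import Data.Sum using (_⊎_; inj₁; inj₂)
open import Relation.Binary.PropositionalEquality
open import Relation.Nullary using (Dec; yes; no)
open import Data.Empty using (⊥-elim)

window-offset : ∀ {i ℓ x} → i ≤ x → x ≤ i + ℓ → Σ[ k ∈ ℕ ] k ≤ ℓ × x ≡ i + k
window-offset {i} {ℓ} {x} i≤x x≤i+ℓ =
  x ∸ i , +-cancelˡ-≤ i _ _ (subst (_≤ i + ℓ) (sym x≡i+k) x≤i+ℓ) , sym x≡i+k
  where
    x≡i+k : i + (x ∸ i) ≡ x
    x≡i+k = m+[n∸m]≡n i≤x

maxUpTo-lub : ∀ (C : ℕ → ℕ) M n → (∀ x → x < n → C x ≤ M) → maxUpTo C n ≤ M
maxUpTo-lub C M zero    bound = z≤n
maxUpTo-lub C M (suc n) bound =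
  ⊔-lub (maxUpTo-lub C M n (λ x x<n → bound x (m<n⇒m<1+n x<n))) (bound n ≤-refl)

module Height (C : ℕ → ℕ) where

  Settled : ℕ → Set
  Settled e = ∀ x → x < e → C x + x ≤ e

  settled-suffix : ∀ s ℓ → Settled (s + ℓ) → ∀ k → k < ℓ → C (s + k) + k ≤ ℓ
  settled-suffix s ℓ settled k k<ℓ =
    +-cancelˡ-≤ s _ _ (subst (_≤ s + ℓ) (x∙yz≈y∙xz (C (s + k)) s k)
                             (settled (s + k) (+-monoʳ-< s k<ℓ)))

  PhraseBound : ℕ → ℕ → Set
  PhraseBound i ℓ = ∀ k → k ≤ ℓ → C (i + k) + k ≤ suc ℓ

  SettledSource : ℕ → ℕ → Set
  SettledSource ℓ t = ℓ ≡ 0 ⊎ (ℓ ≤ t × Settled t)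

  -- The height equations of a phrase T[i, i+ℓ] with settled source imply
  -- the phrase bound: the last character has height 1, and a copied
  -- position is one above a source position at distance ℓ-k from t.
  phrase-height : ∀ i ℓ t → SettledSource ℓ t →
    C (i + ℓ) ≡ 1 → (∀ k → k < ℓ → C (i + k) ≡ suc (C (t ∸ ℓ + k))) →
    PhraseBound i ℓ
  phrase-height i ℓ t source last copied k k≤ℓ with m≤n⇒m<n∨m≡n k≤ℓ | source
  ... | inj₂ refl | _ rewrite last = ≤-refl
  ... | inj₁ k<ℓ  | inj₁ refl = ⊥-elim (n≮0 k<ℓ)
  ... | inj₁ k<ℓ  | inj₂ (ℓ≤t , settled-t) rewrite copied k k<ℓ =
    s≤s (settled-suffix (t ∸ ℓ) ℓ settled-start k k<ℓ)
    where
      settled-start : Settled (t ∸ ℓ + ℓ)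
      settled-start = subst Settled (sym (m∸n+n≡m ℓ≤t)) settled-t

  -- An LZ-End source ends at an earlier phrase end, so it is settled.
  settled-source : ∀ {A : Set} (T : List A) Es i ℓ t → All Settled Es →
    ℓ ≡ 0 ⊎ SourceAt T Es i ℓ t → SettledSource ℓ t
  settled-source T Es i ℓ t settled-ends (inj₁ ℓ≡0) = inj₁ ℓ≡0
  settled-source T Es i ℓ t settled-ends (inj₂ (t∈Es , ℓ≤t , _)) =
    inj₂ (ℓ≤t , lookup settled-ends t∈Es)

  settle-phrase : ∀ i ℓ → Settled i → PhraseBound i ℓ →
    Settled (suc (i + ℓ))
  settle-phrase i ℓ settled-i bound y y<end with y <? i
  ... | yes y<i = ≤-trans (settled-i y y<i) (m≤n⇒m≤1+n (m≤m+n i ℓ))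
  ... | no y≮i with window-offset (≮⇒≥ y≮i) (≤-pred y<end)
  ...   | k , k≤ℓ , refl =
    subst₂ _≤_ (x∙yz≈y∙xz i (C (i + k)) k) (+-suc i ℓ) (+-monoʳ-≤ i (bound k k≤ℓ))

  within-phrase : ∀ i ℓ → PhraseBound i ℓ →
    ∀ {x} → i ≤ x → x ≤ i + ℓ → C x ≤ suc ℓ
  within-phrase i ℓ bound i≤x x≤end with window-offset i≤x x≤end
  ... | k , k≤ℓ , refl = ≤-trans (m≤m+n (C (i + k)) k) (bound k k≤ℓ)

  heights-bounded : ∀ {A : Set} (T : List A) Es i Z → LZEndFrom T Es i Z →
    Settled i → All Settled Es → IsHeightArray Z C →
    ∀ x → i ≤ x → x < length T → C x ≤ maxPhraseLength Z
  heights-bounded T Es _ _ (done _) _ _ _ x n≤x x<n = ⊥-elim (<⇒≱ x<n n≤x)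
  heights-bounded T Es i ((i , ℓ , t) ∷ Z) (step _ _ ℓ t Z _ src _ rest)
                  settled-i settled-ends ((last , copied) ∷ heights) x i≤x x<n =
    phrase-or-later (x <? suc (i + ℓ))
    where
      bound : PhraseBound i ℓ
      bound = phrase-height i ℓ t (settled-source T Es i ℓ t settled-ends src) last copied

      settled-end : Settled (suc (i + ℓ))
      settled-end = settle-phrase i ℓ settled-i bound

      phrase-or-later : Dec (x < suc (i + ℓ)) → C x ≤ suc ℓ ⊔ maxPhraseLength Z
      phrase-or-later (yes x<end) =
        ≤-trans (within-phrase i ℓ bound i≤x (≤-pred x<end))
                (m≤m⊔n (suc ℓ) (maxPhraseLength Z))
      phrase-or-later (no x≮end) =
        ≤-trans (heights-bounded T _ _ Z rest settled-end (settled-end ∷ settled-ends) heights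
                                 x (≮⇒≥ x≮end) x<n)
                (m≤n⊔m (suc ℓ) (maxPhraseLength Z))

lemma4p2 : {A : Set} (T : List A) (Z : List Phrase) (C : ℕ → ℕ) →
    IsLZEnd T Z → IsHeightArray Z C →
    maxUpTo C (length T) ≤ maxPhraseLength Z
lemma4p2 T Z C parsing heights =
  maxUpTo-lub C (maxPhraseLength Z) (length T)
    (λ x x<n → heights-bounded T [] 0 Z parsing nothing-before [] heights x z≤n x<n)
  where
    open Height C
    nothing-before : Settled 0
    nothing-before _ ()
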